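{- Let $q=p^m$ be a power of a prime $p$, and let $n,r$ be positive integers such that $d:=(m,r)=(mn,r)$, $p\nmid n$ and $(n,p^{(m,r)}-1)=1$. Then \[f(x)=a\left(x^{p^r}-xT_{q^n|q}(x)^{p^r-1}\right)+bx\] is a complete permutation polynomial over $\mathbb{F}_{q^n}$ for each $a\in\mathbb{F}_q$ and each $b\in\mathbb{F}_q\setminus\{ -1,0\}$.
   Context: $T_{q^n|q}(x)=\sum_{i=0}^{n-1}x^{q^i}$ is the trace from $\mathbb{F}_{q^n}$ to $\mathbb{F}_q$. A polynomial $h$ is a complete permutation polynomial over a finite field $K$ if both $h(x)$ and $h(x)+x$ induce permutations of $K$. -}

module Defs where

open import Level using (Level)
open import Data.Nat using (ℕ; zero; suc)
open import Data.Fin using (Fin)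
open import Data.Product using (Σ; ∃; _×_)
open import Relation.Nullary using (¬_)
open import Relation.Binary.PropositionalEquality using (_≡_)
open import Algebra.Bundles using (CommutativeRing)

module _ {c ℓ : Level} (R : CommutativeRing c ℓ) where
  open CommutativeRing R

  pow : Carrier → ℕ → Carrier
  pow x zero = 1#
  pow x (suc k) = x * pow x k

  IsField : Set (c Level.⊔ ℓ)
  IsField = (¬ (1# ≈ 0#)) × (∀ x → ¬ (x ≈ 0#) → Σ Carrier λ y → (x * y) ≈ 1#)

  HasCardinality : ℕ → Set (c Level.⊔ ℓ)
  HasCardinality N = Σ (Fin N → Carrier) λ e →
    (∀ i j → e i ≈ e j → i ≡ j) × (∀ x → Σ (Fin N) λ i → e i ≈ x)

  IsPermutation : (Carrier → Carrier) → Set (c Level.⊔ ℓ)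
  IsPermutation g = (∀ x y → x ≈ y → g x ≈ g y)
                  × (∀ x y → g x ≈ g y → x ≈ y)
                  × (∀ y → Σ Carrier λ x → g x ≈ y)

  IsCompletePermutation : (Carrier → Carrier) → Set (c Level.⊔ ℓ)
  IsCompletePermutation g = IsPermutation g × IsPermutation (λ x → g x + x)

  sumTo : ℕ → (ℕ → Carrier) → Carrier
  sumTo zero g = 0#
  sumTo (suc k) g = sumTo k g + g k

  trace : ℕ → ℕ → Carrier → Carrier
  trace q n x = sumTo n (λ i → pow x (q Data.Nat.^ i))

  -- f(x) = a (x^{p^r} - x T_{q^n|q}(x)^{p^r - 1}) + b x,  with q and P = p^r given
  cppMap : (q n P : ℕ) (a b : Carrier) → Carrier → Carrier
  cppMap q n P a b x = (a * (pow x P - x * pow (trace q n x) (P Data.Nat.∸ 1))) + b * x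

-- Let T be the trace and P = p ^ r. Since T is 𝔽q-linear and commutes with P-th powers,
-- T (f x) = b · T x; so f x = f y forces T x = T y, and z = x − y then satisfies T z = 0 and
-- a z^P + (b − a T(x)^(P−1)) z = 0, i.e. z = 0 (if a = 0) or z^P = e z with e ∈ 𝔽q.
-- For z ≠ 0 the exponents w with z^(p^w) ∈ 𝔽q·z are closed under addition and cancellation
-- and contain r and mn, hence gcd (mn) r = gcd m r = d and its multiple m. So z^q = μ z with
-- μ ∈ 𝔽q, μ^n = 1 and μ^(p^d − 1) = 1, whence μ = 1, z ∈ 𝔽q and T z = n z ≠ 0 as p ∤ n.
-- Thus f is injective, hence bijective on the finite field, and so is f x + x, which is the
-- same map with b replaced by b + 1 ≠ 0.

module Submission where

open import Level using (Level)
open import Algebra.Bundles using (CommutativeRing; CommutativeMonoid)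
open import Data.Nat as ℕ using (ℕ; zero; suc; _≥_; _∸_; _<_; _!; z≤n; s≤s)
import Data.Nat.Properties as ℕ
open import Data.Nat.Properties using (_!*_!≢0)
open import Data.Nat.Combinatorics using (_C_; nCk≡n!/k![n-k]!; k![n∸k]!∣n!; nCn≡1)
open import Data.Nat.DivMod using (m/n*n≡m)
open import Data.Nat.Divisibility using (_∣_; divides; ∣1⇒≡1; ∣⇒≤)
open import Data.Nat.GCD using (gcd; gcd-GCD; gcd[m,n]∣m; module Bézout)
open import Data.Nat.Primality using (Prime; euclidsLemma; prime⇒irreducible; prime⇒nonZero)
open import Data.Nat.Coprimality using (Coprime; coprime⇒gcd≡1)
open import Data.Fin as Fin using (Fin; punchOut)
import Data.Fin.Properties as Fin
open import Data.Product using (Σ; ∃₂; _×_; _,_; proj₁; proj₂)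
open import Data.Sum using (inj₁; inj₂)
open import Data.Empty using (⊥; ⊥-elim)
open import Relation.Nullary using (¬_; Dec; yes; no)
open import Relation.Binary.PropositionalEquality as ≡ using (_≡_; _≢_)

open import Defs

prime∤! : ∀ {p} → Prime p → ∀ {k} → k < p → ¬ p ∣ k !
prime∤! {p} pr {zero} _ p∣1 with ∣1⇒≡1 p∣1
... | ≡.refl with () ← pr
prime∤! pr {suc k} k<p p∣k! with euclidsLemma (suc k) (k !) pr p∣k!
... | inj₁ p∣1+k = ℕ.<⇒≱ k<p (∣⇒≤ p∣1+k)
... | inj₂ p∣k! = prime∤! pr (ℕ.<-trans (ℕ.n<1+n k) k<p) p∣k!

prime∣binomial : ∀ {p} → Prime p → ∀ {k} → 0 < k → k < p → p ∣ p C k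
prime∣binomial {p@(suc p-1)} pr {k} 0<k k<p
  with euclidsLemma (p C k) (k ! ℕ.* (p ∸ k) !) pr p∣C*k!*[p∸k]!
  where
  instance _ = k !* (p ∸ k) !≢0
  C*k!*[p∸k]!≡p! : (p C k) ℕ.* (k ! ℕ.* (p ∸ k) !) ≡ p !
  C*k!*[p∸k]!≡p! = ≡.trans (≡.cong (ℕ._* (k ! ℕ.* (p ∸ k) !)) (nCk≡n!/k![n-k]! (ℕ.<⇒≤ k<p)))
                           (m/n*n≡m (k![n∸k]!∣n! (ℕ.<⇒≤ k<p)))
  p∣C*k!*[p∸k]! : p ∣ (p C k) ℕ.* (k ! ℕ.* (p ∸ k) !)
  p∣C*k!*[p∸k]! = ≡.subst (p ∣_) (≡.sym C*k!*[p∸k]!≡p!) (divides (p-1 !) (ℕ.*-comm p (p-1 !)))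
... | inj₁ p∣C = p∣C
... | inj₂ p∣k!*[p∸k]! with euclidsLemma (k !) ((p ∸ k) !) pr p∣k!*[p∸k]!
...   | inj₁ p∣k! = ⊥-elim (prime∤! pr k<p p∣k!)
...   | inj₂ p∣[p∸k]! = ⊥-elim (prime∤! pr (ℕ.∸-monoʳ-< {p} {k} {0} 0<k (ℕ.<⇒≤ k<p)) p∣[p∸k]!)

prime∤⇒coprime : ∀ {p n} → Prime p → ¬ p ∣ n → Coprime p n
prime∤⇒coprime pr p∤n (d∣p , d∣n) with prime⇒irreducible pr d∣p
... | inj₁ d≡1 = d≡1
... | inj₂ ≡.refl = ⊥-elim (p∤n d∣n)

module _ {ℓ : Level} (P : ℕ → Set ℓ)
         (P-+ : ∀ a b → P a → P b → P (a ℕ.+ b))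
         (P-∸ : ∀ a b → P (a ℕ.+ b) → P b → P a) where

  *-closed : ∀ {a} → P a → ∀ k → P (k ℕ.* a)
  *-closed {a} Pa zero = P-∸ 0 a Pa Pa
  *-closed {a} Pa (suc k) = P-+ a (k ℕ.* a) Pa (*-closed Pa k)

  gcd-closed : ∀ {a b} → P a → P b → P (gcd a b)
  gcd-closed {a} {b} Pa Pb with Bézout.identity (gcd-GCD a b)
  ... | Bézout.+- x y eq = P-∸ (gcd a b) (y ℕ.* b) (≡.subst P (≡.sym eq) (*-closed Pa x)) (*-closed Pb y)
  ... | Bézout.-+ x y eq = P-∸ (gcd a b) (x ℕ.* a) (≡.subst P (≡.sym eq) (*-closed Pb y)) (*-closed Pa x)

Fin-injective⇒surjective : ∀ {n} (f : Fin n → Fin n) → (∀ i j → f i ≡ f j → i ≡ j) → ∀ y → Σ (Fin n) λ i → f i ≡ y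
Fin-injective⇒surjective {suc n} f f-inj y with Fin.any? (λ i → f i Fin.≟ y)
... | yes hit = hit
... | no miss = ⊥-elim (no-collision (Fin.pigeonhole (ℕ.n<1+n n) (λ i → punchOut (y≢f i))))
  where
  y≢f : ∀ i → y ≢ f i
  y≢f i y≡fi = miss (i , ≡.sym y≡fi)
  no-collision : ¬ ∃₂ λ i j → i Fin.< j × punchOut (y≢f i) ≡ punchOut (y≢f j)
  no-collision (i , j , i<j , eq) = Fin.<-irrefl (f-inj i j (Fin.punchOut-injective (y≢f i) (y≢f j) eq)) i<j

-- Algebra.Solver.Ring needs a coefficient ring mapping into K; ℤ does, via n ↦ n × 1#.
module IntegerCoefficientSolver {c ℓ} (K : CommutativeRing c ℓ) where
  open CommutativeRing K
  open import Algebra.Properties.Semiring.Mult semiring using (×-homo-+; ×1-homo-*) renaming (_×_ to _×ᵣ_)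
  open import Algebra.Properties.Ring ring using (-‿distribˡ-*; -‿distribʳ-*)
  open import Algebra.Properties.AbelianGroup +-abelianGroup using (ε⁻¹≈ε; ⁻¹-involutive; ⁻¹-∙-comm)
  open import Algebra.Properties.CommutativeSemigroup +-commutativeSemigroup using (interchange; x∙yz≈y∙xz)
  open import Algebra.Solver.Ring.AlmostCommutativeRing using (fromCommutativeRing; _-Raw-AlmostCommutative⟶_)
  import Algebra.Solver.Ring
  open import Data.Integer as ℤ using (ℤ; +_; -[1+_]; _⊖_; sign; ∣_∣; _◃_)
  import Data.Integer.Properties as ℤ
  open import Data.Sign as Sign using (Sign)
  open import Data.Maybe using (map)
  open import Relation.Nullary.Decidable using (dec⇒maybe)
  open import Relation.Binary.Reasoning.Setoid setoid

  private
    signed : Sign → Carrier → Carrier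
    signed Sign.+ x = x
    signed Sign.- x = - x

    ⟦_⟧ : ℤ → Carrier
    ⟦ i ⟧ = signed (sign i) (∣ i ∣ ×ᵣ 1#)

    signed-cong : ∀ s {x y} → x ≈ y → signed s x ≈ signed s y
    signed-cong Sign.+ x≈y = x≈y
    signed-cong Sign.- x≈y = -‿cong x≈y

    signed-* : ∀ s t x y → signed (s Sign.* t) (x * y) ≈ signed s x * signed t y
    signed-* Sign.+ Sign.+ x y = refl
    signed-* Sign.+ Sign.- x y = -‿distribʳ-* x y
    signed-* Sign.- Sign.+ x y = -‿distribˡ-* x y
    signed-* Sign.- Sign.- x y = begin
      x * y        ≈⟨ *-congʳ (⁻¹-involutive x) ⟨
      - - x * y    ≈⟨ -‿distribˡ-* (- x) y ⟨
      - (- x * y)  ≈⟨ -‿distribʳ-* (- x) y ⟩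
      - x * - y    ∎

    ⟦◃⟧ : ∀ s n → ⟦ s ◃ n ⟧ ≈ signed s (n ×ᵣ 1#)
    ⟦◃⟧ Sign.+ zero = refl
    ⟦◃⟧ Sign.- zero = sym ε⁻¹≈ε
    ⟦◃⟧ Sign.+ (suc n) = refl
    ⟦◃⟧ Sign.- (suc n) = refl

    ⟦⊖⟧ : ∀ m n → ⟦ m ⊖ n ⟧ ≈ m ×ᵣ 1# - n ×ᵣ 1#
    ⟦⊖⟧ zero zero = sym (-‿inverseʳ 0#)
    ⟦⊖⟧ zero (suc n) = sym (+-identityˡ _)
    ⟦⊖⟧ (suc m) zero = trans (sym (+-identityʳ _)) (+-congˡ (sym ε⁻¹≈ε))
    ⟦⊖⟧ (suc m) (suc n) = begin
      ⟦ suc m ⊖ suc n ⟧                  ≡⟨ ≡.cong ⟦_⟧ (ℤ.[1+m]⊖[1+n]≡m⊖n m n) ⟩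
      ⟦ m ⊖ n ⟧                          ≈⟨ ⟦⊖⟧ m n ⟩
      m ×ᵣ 1# - n ×ᵣ 1#                  ≈⟨ +-identityˡ _ ⟨
      0# + (m ×ᵣ 1# - n ×ᵣ 1#)           ≈⟨ +-congʳ (-‿inverseʳ 1#) ⟨
      (1# - 1#) + (m ×ᵣ 1# - n ×ᵣ 1#)    ≈⟨ interchange 1# (- 1#) (m ×ᵣ 1#) (- (n ×ᵣ 1#)) ⟩
      (1# + m ×ᵣ 1#) + (- 1# - n ×ᵣ 1#)  ≈⟨ +-congˡ (⁻¹-∙-comm 1# (n ×ᵣ 1#)) ⟩
      (1# + m ×ᵣ 1#) - (1# + n ×ᵣ 1#)    ∎

    +-homo : ∀ i j → ⟦ i ℤ.+ j ⟧ ≈ ⟦ i ⟧ + ⟦ j ⟧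
    +-homo (+ m) (+ n) = ×-homo-+ 1# m n
    +-homo (+ m) -[1+ n ] = ⟦⊖⟧ m (suc n)
    +-homo -[1+ m ] (+ n) = trans (⟦⊖⟧ n (suc m)) (+-comm _ _)
    +-homo -[1+ m ] -[1+ n ] = begin
      - (1# + suc (m ℕ.+ n) ×ᵣ 1#)      ≈⟨ -‿cong (+-congˡ (×-homo-+ 1# (suc m) n)) ⟩
      - (1# + (suc m ×ᵣ 1# + n ×ᵣ 1#))  ≈⟨ -‿cong (x∙yz≈y∙xz 1# (suc m ×ᵣ 1#) (n ×ᵣ 1#)) ⟩
      - (suc m ×ᵣ 1# + (1# + n ×ᵣ 1#))  ≈⟨ ⁻¹-∙-comm _ _ ⟨
      - (suc m ×ᵣ 1#) - (suc n ×ᵣ 1#)   ∎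

    *-homo : ∀ i j → ⟦ i ℤ.* j ⟧ ≈ ⟦ i ⟧ * ⟦ j ⟧
    *-homo i j = begin
      ⟦ i ℤ.* j ⟧                                                ≈⟨ ⟦◃⟧ (sign i Sign.* sign j) (∣ i ∣ ℕ.* ∣ j ∣) ⟩
      signed (sign i Sign.* sign j) ((∣ i ∣ ℕ.* ∣ j ∣) ×ᵣ 1#)    ≈⟨ signed-cong (sign i Sign.* sign j) (×1-homo-* ∣ i ∣ ∣ j ∣) ⟩
      signed (sign i Sign.* sign j) (∣ i ∣ ×ᵣ 1# * ∣ j ∣ ×ᵣ 1#)  ≈⟨ signed-* (sign i) (sign j) _ _ ⟩
      ⟦ i ⟧ * ⟦ j ⟧                                              ∎

    -‿homo : ∀ i → ⟦ ℤ.- i ⟧ ≈ - ⟦ i ⟧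
    -‿homo (+ zero) = sym ε⁻¹≈ε
    -‿homo (+ suc n) = refl
    -‿homo -[1+ n ] = sym (⁻¹-involutive _)

    ℤ⟶K : ℤ.+-*-rawRing -Raw-AlmostCommutative⟶ fromCommutativeRing K
    ℤ⟶K = record
      { ⟦_⟧ = ⟦_⟧ ; +-homo = +-homo ; *-homo = *-homo ; -‿homo = -‿homo
      ; 0-homo = refl ; 1-homo = +-identityʳ 1# }

  open Algebra.Solver.Ring ℤ.+-*-rawRing (fromCommutativeRing K) ℤ⟶K
    (λ i j → map (λ i≡j → reflexive (≡.cong ⟦_⟧ i≡j)) (dec⇒maybe (i ℤ.≟ j)))
    public using (solve; _:+_; _:*_; _:-_; :-_; _:=_)

module SumToProperties {c ℓ} (K : CommutativeRing c ℓ) where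
  open CommutativeRing K
  open import Algebra.Properties.Semiring.Mult semiring using () renaming (_×_ to _×ᵣ_)
  open import Algebra.Properties.CommutativeSemigroup +-commutativeSemigroup using (interchange)

  sumTo-cong : ∀ n {f g : ℕ → Carrier} → (∀ i → f i ≈ g i) → sumTo K n f ≈ sumTo K n g
  sumTo-cong zero f≈g = refl
  sumTo-cong (suc n) f≈g = +-cong (sumTo-cong n f≈g) (f≈g n)

  sumTo-+ : ∀ n f g → sumTo K n (λ i → f i + g i) ≈ sumTo K n f + sumTo K n g
  sumTo-+ zero f g = sym (+-identityˡ 0#)
  sumTo-+ (suc n) f g = trans (+-congʳ (sumTo-+ n f g)) (interchange _ _ _ _)

  sumTo-*ˡ : ∀ n c f → sumTo K n (λ i → c * f i) ≈ c * sumTo K n f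
  sumTo-*ˡ zero c f = sym (zeroʳ c)
  sumTo-*ˡ (suc n) c f = trans (+-congʳ (sumTo-*ˡ n c f)) (sym (distribˡ c _ _))

  sumTo-unshift : ∀ n f → f 0 + sumTo K n (λ i → f (suc i)) ≈ sumTo K (suc n) f
  sumTo-unshift zero f = trans (+-identityʳ _) (sym (+-identityˡ _))
  sumTo-unshift (suc n) f = trans (sym (+-assoc _ _ _)) (+-congʳ (sumTo-unshift n f))

  sumTo-const : ∀ n x → sumTo K n (λ _ → x) ≈ n ×ᵣ x
  sumTo-const zero x = refl
  sumTo-const (suc n) x = trans (+-congʳ (sumTo-const n x)) (+-comm _ _)

module PowerProperties {c ℓ} (K : CommutativeRing c ℓ) where
  open CommutativeRing K
  open import Algebra.Properties.Semiring.Exp semiring using (^-congˡ; ^-homo-*; ^-assocʳ) renaming (_^_ to _^ᴹ_)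
  open import Algebra.Properties.CommutativeSemiring.Exp commutativeSemiring using () renaming (^-distrib-* to ^ᴹ-distrib-*)
  open import Algebra.Properties.Semiring.Mult semiring using (×-congʳ; ×-assoc-*; ×1-homo-*) renaming (_×_ to _×ᵣ_)
  open import Algebra.Properties.Monoid.Sum +-monoid using (sum; sum-init-last; sum-cong-≋; sum-replicate-zero)
  import Algebra.Properties.CommutativeSemiring.Binomial commutativeSemiring as Binomial
  open import Algebra.Properties.Ring ring using (x+x≈x⇒x≈0)
  open import Algebra.Properties.AbelianGroup +-abelianGroup using (inverseʳ-unique)
  open import Relation.Binary.Reasoning.Setoid setoid

  infixr 8 _^_
  _^_ : Carrier → ℕ → Carrier
  x ^ n = pow K x n

  pow≈^ᴹ : ∀ x n → x ^ n ≈ x ^ᴹ n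
  pow≈^ᴹ x zero = refl
  pow≈^ᴹ x (suc n) = *-congˡ (pow≈^ᴹ x n)

  ^-cong : ∀ n {x y} → x ≈ y → x ^ n ≈ y ^ n
  ^-cong n {x} {y} x≈y = trans (pow≈^ᴹ x n) (trans (^-congˡ n x≈y) (sym (pow≈^ᴹ y n)))

  ^-+ : ∀ x m n → x ^ (m ℕ.+ n) ≈ x ^ m * x ^ n
  ^-+ x m n = trans (pow≈^ᴹ x (m ℕ.+ n)) (trans (^-homo-* x m n) (sym (*-cong (pow≈^ᴹ x m) (pow≈^ᴹ x n))))

  ^-* : ∀ x m n → x ^ (m ℕ.* n) ≈ (x ^ m) ^ n
  ^-* x m n = begin
    x ^ (m ℕ.* n)   ≈⟨ pow≈^ᴹ x (m ℕ.* n) ⟩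
    x ^ᴹ (m ℕ.* n)  ≈⟨ ^-assocʳ x m n ⟨
    (x ^ᴹ m) ^ᴹ n   ≈⟨ ^-congˡ n (pow≈^ᴹ x m) ⟨
    (x ^ m) ^ᴹ n    ≈⟨ pow≈^ᴹ (x ^ m) n ⟨
    (x ^ m) ^ n     ∎

  ^-comm : ∀ x m n → (x ^ m) ^ n ≈ (x ^ n) ^ m
  ^-comm x m n = trans (sym (^-* x m n)) (trans (reflexive (≡.cong (x ^_) (ℕ.*-comm m n))) (^-* x n m))

  ^-distrib-* : ∀ x y n → (x * y) ^ n ≈ x ^ n * y ^ n
  ^-distrib-* x y n = trans (pow≈^ᴹ (x * y) n) (trans (^ᴹ-distrib-* x y n) (sym (*-cong (pow≈^ᴹ x n) (pow≈^ᴹ y n))))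

  1^n≈1 : ∀ n → 1# ^ n ≈ 1#
  1^n≈1 zero = refl
  1^n≈1 (suc n) = trans (*-identityˡ _) (1^n≈1 n)

  ^-×ᵣ1# : ∀ m k → (m ℕ.^ k) ×ᵣ 1# ≈ (m ×ᵣ 1#) ^ k
  ^-×ᵣ1# m zero = +-identityʳ 1#
  ^-×ᵣ1# m (suc k) = trans (×1-homo-* m (m ℕ.^ k)) (*-congˡ (^-×ᵣ1# m k))

  ^≈1-gcd : ∀ x a b → x ^ a ≈ 1# → x ^ b ≈ 1# → x ^ gcd a b ≈ 1#
  ^≈1-gcd x a b = gcd-closed (λ k → x ^ k ≈ 1#) ^≈1-+ ^≈1-∸ {a} {b}
    where
    ^≈1-+ : ∀ a b → x ^ a ≈ 1# → x ^ b ≈ 1# → x ^ (a ℕ.+ b) ≈ 1#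
    ^≈1-+ a b xᵃ≈1 xᵇ≈1 = trans (^-+ x a b) (trans (*-cong xᵃ≈1 xᵇ≈1) (*-identityʳ 1#))
    ^≈1-∸ : ∀ a b → x ^ (a ℕ.+ b) ≈ 1# → x ^ b ≈ 1# → x ^ a ≈ 1#
    ^≈1-∸ a b xᵃ⁺ᵇ≈1 xᵇ≈1 = trans (sym (*-identityʳ _)) (trans (*-congˡ (sym xᵇ≈1)) (trans (sym (^-+ x a b)) xᵃ⁺ᵇ≈1))

  Additive : ℕ → Set (c Level.⊔ ℓ)
  Additive k = ∀ x y → (x + y) ^ k ≈ x ^ k + y ^ k

  additive-1 : Additive 1
  additive-1 x y = trans (*-identityʳ _) (sym (+-cong (*-identityʳ x) (*-identityʳ y)))

  additive-* : ∀ k l → Additive k → Additive l → Additive (k ℕ.* l)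
  additive-* k l add-k add-l x y = begin
    (x + y) ^ (k ℕ.* l)            ≈⟨ ^-* (x + y) k l ⟩
    ((x + y) ^ k) ^ l              ≈⟨ ^-cong l (add-k x y) ⟩
    (x ^ k + y ^ k) ^ l            ≈⟨ add-l _ _ ⟩
    (x ^ k) ^ l + (y ^ k) ^ l      ≈⟨ +-cong (^-* x k l) (^-* y k l) ⟨
    x ^ (k ℕ.* l) + y ^ (k ℕ.* l)  ∎

  additive-^ : ∀ k → Additive k → ∀ i → Additive (k ℕ.^ i)
  additive-^ k add-k zero = additive-1
  additive-^ k add-k (suc i) = additive-* k (k ℕ.^ i) add-k (additive-^ k add-k i)

  additive⇒0^k≈0 : ∀ k → Additive k → 0# ^ k ≈ 0#
  additive⇒0^k≈0 k add-k = x+x≈x⇒x≈0 _ (trans (sym (add-k 0# 0#)) (^-cong k (+-identityʳ 0#)))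

  additive-neg : ∀ k → Additive k → ∀ x → (- x) ^ k ≈ - x ^ k
  additive-neg k add-k x = inverseʳ-unique (x ^ k) ((- x) ^ k) (begin
    x ^ k + (- x) ^ k  ≈⟨ add-k x (- x) ⟨
    (x - x) ^ k        ≈⟨ ^-cong k (-‿inverseʳ x) ⟩
    0# ^ k             ≈⟨ additive⇒0^k≈0 k add-k ⟩
    0#                 ∎)

  additive-sumTo : ∀ k → Additive k → ∀ n f → sumTo K n f ^ k ≈ sumTo K n (λ i → f i ^ k)
  additive-sumTo k add-k zero f = additive⇒0^k≈0 k add-k
  additive-sumTo k add-k (suc n) f = trans (add-k _ _) (+-congʳ (additive-sumTo k add-k n f))

  ∣⇒×ᵣ≈0 : ∀ {p k} x → p ×ᵣ 1# ≈ 0# → p ∣ k → k ×ᵣ x ≈ 0#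
  ∣⇒×ᵣ≈0 {p} x p≈0 (divides s ≡.refl) = begin
    (s ℕ.* p) ×ᵣ x         ≈⟨ ×-congʳ (s ℕ.* p) (*-identityˡ x) ⟨
    (s ℕ.* p) ×ᵣ (1# * x)  ≈⟨ ×-assoc-* (s ℕ.* p) 1# x ⟨
    (s ℕ.* p) ×ᵣ 1# * x    ≈⟨ *-congʳ (×1-homo-* s p) ⟩
    s ×ᵣ 1# * p ×ᵣ 1# * x  ≈⟨ *-congʳ (trans (*-congˡ p≈0) (zeroʳ _)) ⟩
    0# * x                 ≈⟨ zeroˡ x ⟩
    0#                     ∎

  private
    sum-ends : ∀ n (f : Fin (suc (suc n)) → Carrier) → (∀ i → f (Fin.suc (Fin.inject₁ i)) ≈ 0#) →
               sum f ≈ f Fin.zero + f (Fin.fromℕ (suc n))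
    sum-ends n f middle≈0 = +-congˡ (begin
      sum (λ i → f (Fin.suc i))          ≈⟨ sum-init-last (λ i → f (Fin.suc i)) ⟩
      sum (λ i → f (Fin.suc (Fin.inject₁ i))) + f (Fin.fromℕ (suc n))
                                         ≈⟨ +-congʳ (trans (sum-cong-≋ middle≈0) (sum-replicate-zero n)) ⟩
      0# + f (Fin.fromℕ (suc n))         ≈⟨ +-identityˡ _ ⟩
      f (Fin.fromℕ (suc n))              ∎)

  frobenius : ∀ {p} → Prime p → p ×ᵣ 1# ≈ 0# → Additive p
  frobenius {zero} pr with () ← pr
  frobenius {p@(suc p-1)} pr p≈0 x y = begin
    (x + y) ^ p                         ≈⟨ pow≈^ᴹ (x + y) p ⟩
    (x + y) ^ᴹ p                        ≈⟨ Binomial.theorem p x y ⟩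
    Binomial.binomialExpansion x y p    ≈⟨ sum-ends p-1 term middle≈0 ⟩
    term Fin.zero + term (Fin.fromℕ p)  ≈⟨ +-comm _ _ ⟩
    term (Fin.fromℕ p) + term Fin.zero  ≈⟨ +-cong last≈x^p first≈y^p ⟩
    x ^ p + y ^ p                       ∎
    where
    term = Binomial.binomialTerm x y p
    middle≈0 : ∀ i → term (Fin.suc (Fin.inject₁ i)) ≈ 0#
    middle≈0 i = ∣⇒×ᵣ≈0 _ p≈0 (prime∣binomial pr (s≤s z≤n) (s≤s (Fin.inject₁ℕ< i)))
    first≈y^p : term Fin.zero ≈ y ^ p
    first≈y^p = trans (+-identityʳ _) (trans (*-identityˡ _) (sym (pow≈^ᴹ y p)))
    last≈x^p : term (Fin.fromℕ p) ≈ x ^ p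
    last≈x^p = begin
      (p C Fin.toℕ (Fin.fromℕ p)) ×ᵣ (x ^ᴹ Fin.toℕ (Fin.fromℕ p) * y ^ᴹ (p ∸ Fin.toℕ (Fin.fromℕ p)))
          ≡⟨ ≡.cong (λ k → (p C k) ×ᵣ (x ^ᴹ k * y ^ᴹ (p ∸ k))) (Fin.toℕ-fromℕ p) ⟩
      (p C p) ×ᵣ (x ^ᴹ p * y ^ᴹ (p ∸ p))
          ≡⟨ ≡.cong₂ (λ c e → c ×ᵣ (x ^ᴹ p * y ^ᴹ e)) (nCn≡1 p) (ℕ.n∸n≡0 p) ⟩
      1 ×ᵣ (x ^ᴹ p * 1#)                ≈⟨ +-identityʳ _ ⟩
      x ^ᴹ p * 1#                       ≈⟨ *-identityʳ _ ⟩
      x ^ᴹ p                            ≈⟨ pow≈^ᴹ x p ⟨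
      x ^ p                             ∎

module FieldProperties {c ℓ} (K : CommutativeRing c ℓ) (isField : IsField K) where
  open CommutativeRing K
  open PowerProperties K using (_^_)
  open import Relation.Binary.Reasoning.Setoid setoid

  1≉0 : 1# ≉ 0#
  1≉0 = proj₁ isField

  inverse : ∀ x → x ≉ 0# → Carrier
  inverse x x≉0 = proj₁ (proj₂ isField x x≉0)

  *-inverseʳ : ∀ x (x≉0 : x ≉ 0#) → x * inverse x x≉0 ≈ 1#
  *-inverseʳ x x≉0 = proj₂ (proj₂ isField x x≉0)

  *-inverseˡ : ∀ x (x≉0 : x ≉ 0#) → inverse x x≉0 * x ≈ 1#
  *-inverseˡ x x≉0 = trans (*-comm _ x) (*-inverseʳ x x≉0)

  *-cancelʳ : ∀ {z} → z ≉ 0# → ∀ {x y} → x * z ≈ y * z → x ≈ y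
  *-cancelʳ {z} z≉0 {x} {y} xz≈yz = begin
    x                        ≈⟨ *-identityʳ x ⟨
    x * 1#                   ≈⟨ *-congˡ (*-inverseʳ z z≉0) ⟨
    x * (z * inverse z z≉0)  ≈⟨ *-assoc x z _ ⟨
    x * z * inverse z z≉0    ≈⟨ *-congʳ xz≈yz ⟩
    y * z * inverse z z≉0    ≈⟨ *-assoc y z _ ⟩
    y * (z * inverse z z≉0)  ≈⟨ *-congˡ (*-inverseʳ z z≉0) ⟩
    y * 1#                   ≈⟨ *-identityʳ y ⟩
    y                        ∎

  *-cancelˡ : ∀ {z} → z ≉ 0# → ∀ {x y} → z * x ≈ z * y → x ≈ y
  *-cancelˡ z≉0 {x} {y} zx≈zy = *-cancelʳ z≉0 (trans (*-comm x _) (trans zx≈zy (*-comm _ y)))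

  *≈0⇒≈0 : ∀ {x y} → x ≉ 0# → x * y ≈ 0# → y ≈ 0#
  *≈0⇒≈0 {x} x≉0 xy≈0 = *-cancelˡ x≉0 (trans xy≈0 (sym (zeroʳ x)))

  *-≉0 : ∀ {x y} → x ≉ 0# → y ≉ 0# → x * y ≉ 0#
  *-≉0 x≉0 y≉0 xy≈0 = y≉0 (*≈0⇒≈0 x≉0 xy≈0)

  ^-≉0 : ∀ {x} → x ≉ 0# → ∀ n → x ^ n ≉ 0#
  ^-≉0 x≉0 zero = 1≉0
  ^-≉0 x≉0 (suc n) = *-≉0 x≉0 (^-≉0 x≉0 n)

module FiniteFieldProperties {c ℓ} (K : CommutativeRing c ℓ) (isField : IsField K)
                             {N : ℕ} (card : HasCardinality K N) where
  open CommutativeRing K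
  open PowerProperties K using (_^_; pow≈^ᴹ; ^-cong)
  open FieldProperties K isField
  open import Algebra.Properties.Semiring.Mult semiring using () renaming (_×_ to _×ᵣ_)
  open import Algebra.Properties.AbelianGroup +-abelianGroup using (identityʳ-unique; //-rightDividesˡ; //-rightDividesʳ)
  open import Data.Fin.Permutation using (permutation)
  import Algebra.Properties.Monoid.Sum *-monoid as Product
  open import Relation.Binary.Reasoning.Setoid setoid

  private
    enum : Fin N → Carrier
    enum = proj₁ card

    enum-injective : ∀ i j → enum i ≈ enum j → i ≡ j
    enum-injective = proj₁ (proj₂ card)

    index : Carrier → Fin N
    index x = proj₁ (proj₂ (proj₂ card) x)

    enum-index : ∀ x → enum (index x) ≈ x
    enum-index x = proj₂ (proj₂ (proj₂ card) x)

    index-cong : ∀ {x y} → x ≈ y → index x ≡ index y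
    index-cong {x} {y} x≈y = enum-injective _ _ (trans (enum-index x) (trans x≈y (sym (enum-index y))))

    index-enum : ∀ i → index (enum i) ≡ i
    index-enum i = enum-injective _ _ (enum-index (enum i))

    index-injective : ∀ {x y} → index x ≡ index y → x ≈ y
    index-injective {x} {y} ix≡iy = trans (sym (enum-index x)) (trans (reflexive (≡.cong enum ix≡iy)) (enum-index y))

  infix 4 _≟_
  _≟_ : ∀ x y → Dec (x ≈ y)
  x ≟ y with index x Fin.≟ index y
  ... | yes ix≡iy = yes (index-injective ix≡iy)
  ... | no ix≢iy = no (λ x≈y → ix≢iy (index-cong x≈y))

  ^≈0⇒≈0 : ∀ n {x} → x ^ n ≈ 0# → x ≈ 0#
  ^≈0⇒≈0 n {x} xⁿ≈0 with x ≟ 0#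
  ... | yes x≈0 = x≈0
  ... | no x≉0 = ⊥-elim (^-≉0 x≉0 n xⁿ≈0)

  0^N≈0 : 0# ^ N ≈ 0#
  0^N≈0 = trans (reflexive (≡.cong (0# ^_) (≡.sym (ℕ.suc-pred N)))) (zeroˡ _)
    where instance _ = Fin.nonZeroIndex (index 0#)

  injective⇒permutation : ∀ f → (∀ {x y} → x ≈ y → f x ≈ f y) → (∀ x y → f x ≈ f y → x ≈ y) → IsPermutation K f
  injective⇒permutation f f-cong f-injective = (λ _ _ → f-cong) , f-injective , f-surjective
    where
    f-surjective : ∀ y → Σ Carrier λ x → f x ≈ y
    f-surjective y with Fin-injective⇒surjective (λ i → index (f (enum i)))
                          (λ i j eq → enum-injective i j (f-injective _ _ (index-injective eq))) (index y)
    ... | i , eq = enum i , index-injective eq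

  module ∑-over-K {a ℓ′} (M : CommutativeMonoid a ℓ′) where
    private module M = CommutativeMonoid M
    open import Algebra.Properties.CommutativeMonoid.Sum M
      using (sum; ∑-permute; ∑-distrib-+; sum-cong-≋; sum-remove; sum-replicate; sum-replicate-zero)
    open import Algebra.Properties.Monoid.Mult M.monoid using () renaming (_×_ to _×ᴹ_)

    ∑ : (Carrier → M.Carrier) → M.Carrier
    ∑ F = sum (λ i → F (enum i))

    ∑-bijection : ∀ {F} → (∀ {x y} → x ≈ y → F x M.≈ F y) →
                  ∀ (h h⁻¹ : Carrier → Carrier) → (∀ {x y} → x ≈ y → h x ≈ h y) → (∀ {x y} → x ≈ y → h⁻¹ x ≈ h⁻¹ y) →
                  (∀ x → h (h⁻¹ x) ≈ x) → (∀ x → h⁻¹ (h x) ≈ x) →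
                  ∑ F M.≈ ∑ (λ x → F (h x))
    ∑-bijection {F} F-cong h h⁻¹ h-cong h⁻¹-cong h∘h⁻¹ h⁻¹∘h =
      M.trans (∑-permute (λ i → F (enum i)) π) (sum-cong-≋ {N} (λ i → F-cong (enum-index (h (enum i)))))
      where
      f g : Fin N → Fin N
      f i = index (h (enum i))
      g j = index (h⁻¹ (enum j))
      f∘g : ∀ j → f (g j) ≡ j
      f∘g j = ≡.trans (index-cong (trans (h-cong (enum-index _)) (h∘h⁻¹ (enum j)))) (index-enum j)
      g∘f : ∀ i → g (f i) ≡ i
      g∘f i = ≡.trans (index-cong (trans (h⁻¹-cong (enum-index _)) (h⁻¹∘h (enum i)))) (index-enum i)
      π = permutation f g f∘g g∘f

    ∑-single : ∀ {F} → (∀ {x y} → x ≈ y → F x M.≈ F y) → ∀ x₀ → (∀ x → x ≉ x₀ → F x M.≈ M.ε) → ∑ F M.≈ F x₀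
    ∑-single {F} F-cong x₀ F≈ε = M.trans (sum-single (λ i → F (enum i)) (index x₀) off-i₀) (F-cong (enum-index x₀))
      where
      off-i₀ : ∀ j → j ≢ index x₀ → F (enum j) M.≈ M.ε
      off-i₀ j j≢i₀ = F≈ε (enum j) (λ ej≈x₀ → j≢i₀ (≡.trans (≡.sym (index-enum j)) (index-cong ej≈x₀)))
      sum-single : ∀ {n} (t : Fin n → M.Carrier) i → (∀ j → j ≢ i → t j M.≈ M.ε) → sum t M.≈ t i
      sum-single {suc n} t i t≈ε = M.trans (sum-remove {i = i} t) (M.trans
        (M.∙-congˡ (M.trans (sum-cong-≋ (λ j → t≈ε _ (Fin.punchInᵢ≢i i j))) (sum-replicate-zero n)))
        (M.identityʳ _))

    ∑-cong : ∀ {F G} → (∀ x → F x M.≈ G x) → ∑ F M.≈ ∑ G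
    ∑-cong F≈G = sum-cong-≋ (λ i → F≈G (enum i))

    ∑-∙ : ∀ F G → ∑ (λ x → F x M.∙ G x) M.≈ ∑ F M.∙ ∑ G
    ∑-∙ F G = ∑-distrib-+ (λ i → F (enum i)) (λ i → G (enum i))

    ∑-const : ∀ m → ∑ (λ _ → m) M.≈ N ×ᴹ m
    ∑-const m = sum-replicate N

  characteristic : N ×ᵣ 1# ≈ 0#
  characteristic = identityʳ-unique S (N ×ᵣ 1#) (sym (begin
    S                 ≈⟨ ∑-bijection (λ x≈y → x≈y) (_+ 1#) (_- 1#) +-congʳ +-congʳ (//-rightDividesˡ 1#) (//-rightDividesʳ 1#) ⟩
    ∑ (λ x → x + 1#)  ≈⟨ ∑-∙ (λ x → x) (λ _ → 1#) ⟩
    S + ∑ (λ _ → 1#)  ≈⟨ +-congˡ (∑-const 1#) ⟩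
    S + N ×ᵣ 1#       ∎))
    where
    open ∑-over-K +-commutativeMonoid
    S = ∑ (λ x → x)

  -- Fermat by the product argument: unit replaces 0 by 1, so ∏ unit ≉ 0 is invariant under
  -- y ↦ x y, and unit (x y) · (x at0) y = x · unit y corrects the single factor at y = 0.
  private
    unit : Carrier → Carrier
    unit x with x ≟ 0#
    ... | yes _ = 1#
    ... | no _ = x

    unit-cong : ∀ {x y} → x ≈ y → unit x ≈ unit y
    unit-cong {x} {y} x≈y with x ≟ 0# | y ≟ 0#
    ... | yes _ | yes _ = refl
    ... | yes x≈0 | no y≉0 = ⊥-elim (y≉0 (trans (sym x≈y) x≈0))
    ... | no x≉0 | yes y≈0 = ⊥-elim (x≉0 (trans x≈y y≈0))
    ... | no _ | no _ = x≈y

    unit-≉0 : ∀ x → unit x ≉ 0#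
    unit-≉0 x with x ≟ 0#
    ... | yes _ = 1≉0
    ... | no x≉0 = x≉0

    _at0 : Carrier → Carrier → Carrier
    (a at0) x with x ≟ 0#
    ... | yes _ = a
    ... | no _ = 1#

    at0-cong : ∀ a {x y} → x ≈ y → (a at0) x ≈ (a at0) y
    at0-cong a {x} {y} x≈y with x ≟ 0# | y ≟ 0#
    ... | yes _ | yes _ = refl
    ... | yes x≈0 | no y≉0 = ⊥-elim (y≉0 (trans (sym x≈y) x≈0))
    ... | no x≉0 | yes y≈0 = ⊥-elim (x≉0 (trans x≈y y≈0))
    ... | no _ | no _ = refl

    at0-off : ∀ a {x} → x ≉ 0# → (a at0) x ≈ 1#
    at0-off a {x} x≉0 with x ≟ 0#
    ... | yes x≈0 = ⊥-elim (x≉0 x≈0)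
    ... | no _ = refl

    at0-at : ∀ a → (a at0) 0# ≈ a
    at0-at a with 0# ≟ 0#
    ... | yes _ = refl
    ... | no 0≉0 = ⊥-elim (0≉0 refl)

    product-≉0 : ∀ {n} (t : Fin n → Carrier) → (∀ i → t i ≉ 0#) → Product.sum t ≉ 0#
    product-≉0 {zero} t t≉0 = 1≉0
    product-≉0 {suc n} t t≉0 = *-≉0 (t≉0 Fin.zero) (product-≉0 (λ i → t (Fin.suc i)) (λ i → t≉0 (Fin.suc i)))

    unit-*-at0 : ∀ {a} → a ≉ 0# → ∀ x → unit (a * x) * (a at0) x ≈ a * unit x
    unit-*-at0 {a} a≉0 x with a * x ≟ 0# | x ≟ 0#
    ... | yes _ | yes _ = trans (*-identityˡ a) (sym (*-identityʳ a))
    ... | yes ax≈0 | no x≉0 = ⊥-elim (*-≉0 a≉0 x≉0 ax≈0)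
    ... | no ax≉0 | yes x≈0 = ⊥-elim (ax≉0 (trans (*-congˡ x≈0) (zeroʳ a)))
    ... | no _ | no _ = *-identityʳ _

  fermat : ∀ x → x ^ N ≈ x
  fermat x with x ≟ 0#
  ... | yes x≈0 = trans (^-cong N x≈0) (trans 0^N≈0 (sym x≈0))
  ... | no x≉0 = *-cancelʳ (product-≉0 (λ i → unit (enum i)) (λ i → unit-≉0 (enum i))) (begin
    x ^ N * ∏ unit                      ≈⟨ *-congʳ (trans (pow≈^ᴹ x N) (sym (∑-const x))) ⟩
    ∏ (λ _ → x) * ∏ unit                ≈⟨ ∑-∙ (λ _ → x) unit ⟨
    ∏ (λ y → x * unit y)                ≈⟨ ∑-cong (λ y → sym (unit-*-at0 x≉0 y)) ⟩
    ∏ (λ y → unit (x * y) * (x at0) y)  ≈⟨ ∑-∙ (λ y → unit (x * y)) (x at0) ⟩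
    ∏ (λ y → unit (x * y)) * ∏ (x at0)  ≈⟨ *-cong ∏unit-invariant ∏at0 ⟩
    ∏ unit * x                          ≈⟨ *-comm _ x ⟩
    x * ∏ unit                          ∎)
    where
    open ∑-over-K *-commutativeMonoid renaming (∑ to ∏)
    ∏unit-invariant : ∏ (λ y → unit (x * y)) ≈ ∏ unit
    ∏unit-invariant = sym (∑-bijection unit-cong (x *_) (inverse x x≉0 *_) *-congˡ *-congˡ
      (λ y → trans (sym (*-assoc _ _ y)) (trans (*-congʳ (*-inverseʳ x x≉0)) (*-identityˡ y)))
      (λ y → trans (sym (*-assoc _ _ y)) (trans (*-congʳ (*-inverseˡ x x≉0)) (*-identityˡ y))))
    ∏at0 : ∏ (x at0) ≈ x
    ∏at0 = trans (∑-single (at0-cong x) 0# (λ y → at0-off x)) (at0-at x)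

module PrimeCharacteristic {c ℓ} (K : CommutativeRing c ℓ) (isField : IsField K)
                           {p : ℕ} (prime : Prime p) {k : ℕ} (card : HasCardinality K (p ℕ.^ k)) where
  open CommutativeRing K
  open PowerProperties K
  open FieldProperties K isField using (1≉0)
  open FiniteFieldProperties K isField card using (characteristic; ^≈0⇒≈0)
  open import Algebra.Properties.Semiring.Mult semiring using (×-homo-+) renaming (_×_ to _×ᵣ_)

  p×1≈0 : p ×ᵣ 1# ≈ 0#
  p×1≈0 = ^≈0⇒≈0 k (trans (sym (^-×ᵣ1# p k)) characteristic)

  additive-p^ : ∀ j → Additive (p ℕ.^ j)
  additive-p^ = additive-^ p (frobenius prime p×1≈0)

  ∤⇒×ᵣ1≉0 : ∀ {n} → ¬ p ∣ n → n ×ᵣ 1# ≉ 0#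
  ∤⇒×ᵣ1≉0 {n} p∤n n≈0 = 1≉0 (trans (sym (+-identityʳ 1#)) (≡.subst (λ d → d ×ᵣ 1# ≈ 0#)
    (coprime⇒gcd≡1 (prime∤⇒coprime prime p∤n)) (gcd-closed (λ d → d ×ᵣ 1# ≈ 0#) kernel-+ kernel-∸ {p} {n} p×1≈0 n≈0)))
    where
    kernel-+ : ∀ a b → a ×ᵣ 1# ≈ 0# → b ×ᵣ 1# ≈ 0# → (a ℕ.+ b) ×ᵣ 1# ≈ 0#
    kernel-+ a b a≈0 b≈0 = trans (×-homo-+ 1# a b) (trans (+-cong a≈0 b≈0) (+-identityʳ 0#))
    kernel-∸ : ∀ a b → (a ℕ.+ b) ×ᵣ 1# ≈ 0# → b ×ᵣ 1# ≈ 0# → a ×ᵣ 1# ≈ 0#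
    kernel-∸ a b a+b≈0 b≈0 = trans (sym (+-identityʳ _)) (trans (+-congˡ (sym b≈0)) (trans (sym (×-homo-+ 1# a b)) a+b≈0))

module SubfieldTrace {c ℓ} (K : CommutativeRing c ℓ) (isField : IsField K)
                     {p : ℕ} (prime : Prime p) (m n : ℕ) (card : HasCardinality K (p ℕ.^ (m ℕ.* n))) where
  open CommutativeRing K
  open PowerProperties K
  open SumToProperties K
  open FieldProperties K isField
  open FiniteFieldProperties K isField card using (fermat)
  open PrimeCharacteristic K isField prime {m ℕ.* n} card using (additive-p^)
  open import Algebra.Properties.AbelianGroup +-abelianGroup using (∙-cancelˡ)
  open import Algebra.Properties.Ring ring using (-1*x≈-x)
  open import Relation.Binary.Reasoning.Setoid setoid

  q : ℕ
  q = p ℕ.^ m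

  q^n≡N : q ℕ.^ n ≡ p ℕ.^ (m ℕ.* n)
  q^n≡N = ℕ.^-*-assoc p m n

  infix 4 _∈𝔽q
  _∈𝔽q : Carrier → Set ℓ
  x ∈𝔽q = x ^ q ≈ x

  1∈𝔽q : 1# ∈𝔽q
  1∈𝔽q = 1^n≈1 q

  +-∈𝔽q : ∀ {x y} → x ∈𝔽q → y ∈𝔽q → x + y ∈𝔽q
  +-∈𝔽q x∈𝔽q y∈𝔽q = trans (additive-p^ m _ _) (+-cong x∈𝔽q y∈𝔽q)

  *-∈𝔽q : ∀ {x y} → x ∈𝔽q → y ∈𝔽q → x * y ∈𝔽q
  *-∈𝔽q x∈𝔽q y∈𝔽q = trans (^-distrib-* _ _ q) (*-cong x∈𝔽q y∈𝔽q)

  -‿∈𝔽q : ∀ {x} → x ∈𝔽q → - x ∈𝔽q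
  -‿∈𝔽q x∈𝔽q = trans (additive-neg q (additive-p^ m) _) (-‿cong x∈𝔽q)

  ^-∈𝔽q : ∀ {x} k → x ∈𝔽q → x ^ k ∈𝔽q
  ^-∈𝔽q {x} k x∈𝔽q = trans (^-comm x k q) (^-cong k x∈𝔽q)

  inverse-∈𝔽q : ∀ {x} (x≉0 : x ≉ 0#) → x ∈𝔽q → inverse x x≉0 ∈𝔽q
  inverse-∈𝔽q {x} x≉0 x∈𝔽q = *-cancelʳ x≉0 (begin
    inverse x x≉0 ^ q * x      ≈⟨ *-congˡ x∈𝔽q ⟨
    inverse x x≉0 ^ q * x ^ q  ≈⟨ ^-distrib-* _ x q ⟨
    (inverse x x≉0 * x) ^ q    ≈⟨ ^-cong q (*-inverseˡ x x≉0) ⟩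
    1# ^ q                     ≈⟨ 1∈𝔽q ⟩
    1#                         ≈⟨ *-inverseˡ x x≉0 ⟨
    inverse x x≉0 * x          ∎)

  ∈𝔽q⇒^q^i : ∀ {x} → x ∈𝔽q → ∀ i → x ^ (q ℕ.^ i) ≈ x
  ∈𝔽q⇒^q^i x∈𝔽q zero = *-identityʳ _
  ∈𝔽q⇒^q^i {x} x∈𝔽q (suc i) = trans (^-* x q (q ℕ.^ i)) (trans (^-cong (q ℕ.^ i) x∈𝔽q) (∈𝔽q⇒^q^i x∈𝔽q i))

  Tr : Carrier → Carrier
  Tr = trace K q n

  Tr-cong : ∀ {x y} → x ≈ y → Tr x ≈ Tr y
  Tr-cong x≈y = sumTo-cong n (λ i → ^-cong (q ℕ.^ i) x≈y)

  Tr-+ : ∀ x y → Tr (x + y) ≈ Tr x + Tr y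
  Tr-+ x y = trans (sumTo-cong n (λ i → additive-^ q (additive-p^ m) i x y)) (sumTo-+ n _ _)

  Tr-*ˡ : ∀ {a} → a ∈𝔽q → ∀ x → Tr (a * x) ≈ a * Tr x
  Tr-*ˡ {a} a∈𝔽q x = trans (sumTo-cong n (λ i → trans (^-distrib-* a x (q ℕ.^ i)) (*-congʳ (∈𝔽q⇒^q^i a∈𝔽q i))))
                            (sumTo-*ˡ n a _)

  Tr-sub : ∀ x y → Tr (x - y) ≈ Tr x - Tr y
  Tr-sub x y = trans (Tr-+ x (- y)) (+-congˡ (begin
    Tr (- y)       ≈⟨ Tr-cong (-1*x≈-x y) ⟨
    Tr (- 1# * y)  ≈⟨ Tr-*ˡ (-‿∈𝔽q 1∈𝔽q) y ⟩
    - 1# * Tr y    ≈⟨ -1*x≈-x (Tr y) ⟩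
    - Tr y         ∎))

  Tr-^p^ : ∀ r x → Tr (x ^ (p ℕ.^ r)) ≈ Tr x ^ (p ℕ.^ r)
  Tr-^p^ r x = sym (trans (additive-sumTo (p ℕ.^ r) (additive-p^ r) n _) (sumTo-cong n (λ i → ^-comm x (q ℕ.^ i) (p ℕ.^ r))))

  Tr-∈𝔽q : ∀ x → Tr x ∈𝔽q
  Tr-∈𝔽q x = begin
    Tr x ^ q                           ≈⟨ additive-sumTo q (additive-p^ m) n f ⟩
    sumTo K n (λ i → f i ^ q)          ≈⟨ sumTo-cong n (λ i → trans (^-comm x (q ℕ.^ i) q) (sym (^-* x q (q ℕ.^ i)))) ⟩
    sumTo K n (λ i → f (suc i))        ≈⟨ ∙-cancelˡ (f 0) _ _ (begin
      f 0 + sumTo K n (λ i → f (suc i))  ≈⟨ sumTo-unshift n f ⟩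
      sumTo K n f + f n                  ≈⟨ +-congˡ fn≈f0 ⟩
      sumTo K n f + f 0                  ≈⟨ +-comm _ _ ⟩
      f 0 + sumTo K n f                  ∎) ⟩
    Tr x                               ∎
    where
    f : ℕ → Carrier
    f i = x ^ (q ℕ.^ i)
    fn≈f0 : f n ≈ f 0
    fn≈f0 = trans (reflexive (≡.cong (x ^_) q^n≡N)) (trans (fermat x) (sym (*-identityʳ x)))

module CompletePermutation {c ℓ} (K : CommutativeRing c ℓ) (isField : IsField K)
         {p : ℕ} (prime : Prime p) (m n r : ℕ) (card : HasCardinality K (p ℕ.^ (m ℕ.* n)))
         (gcd[m,r]≡gcd[mn,r] : gcd m r ≡ gcd (m ℕ.* n) r) (p∤n : ¬ p ∣ n)
         (gcd[n,p^d-1]≡1 : gcd n (p ℕ.^ gcd m r ∸ 1) ≡ 1) where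
  open CommutativeRing K
  open PowerProperties K
  open SumToProperties K
  open FieldProperties K isField
  open FiniteFieldProperties K isField card using (_≟_; fermat; injective⇒permutation)
  open PrimeCharacteristic K isField prime {m ℕ.* n} card using (additive-p^; ∤⇒×ᵣ1≉0)
  open SubfieldTrace K isField prime m n card
  open import Algebra.Properties.Semiring.Mult semiring using (×-congʳ; ×-assoc-*) renaming (_×_ to _×ᵣ_)
  open import Algebra.Properties.AbelianGroup +-abelianGroup using (ε⁻¹≈ε; inverseˡ-unique; x∙y⁻¹≈ε⇒x≈y; x≈y⇒x∙y⁻¹≈ε)
  open IntegerCoefficientSolver K using (solve; _:+_; _:*_; _:-_; :-_; _:=_)
  open import Relation.Binary.Reasoning.Setoid setoid

  d : ℕ
  d = gcd m r

  module _ {z} (z≉0 : z ≉ 0#) where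
    Eigen : ℕ → Set (c Level.⊔ ℓ)
    Eigen w = Σ Carrier λ α → α ∈𝔽q × z ^ (p ℕ.^ w) ≈ α * z

    private
      z^p^a≉0 : ∀ a → z ^ (p ℕ.^ a) ≉ 0#
      z^p^a≉0 a = ^-≉0 z≉0 (p ℕ.^ a)

      shift : ∀ a b {α} → z ^ (p ℕ.^ a) ≈ α * z → z ^ (p ℕ.^ (a ℕ.+ b)) ≈ α ^ (p ℕ.^ b) * z ^ (p ℕ.^ b)
      shift a b {α} eq = begin
        z ^ (p ℕ.^ (a ℕ.+ b))          ≡⟨ ≡.cong (z ^_) (ℕ.^-distribˡ-+-* p a b) ⟩
        z ^ (p ℕ.^ a ℕ.* p ℕ.^ b)      ≈⟨ ^-* z (p ℕ.^ a) (p ℕ.^ b) ⟩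
        (z ^ (p ℕ.^ a)) ^ (p ℕ.^ b)    ≈⟨ ^-cong (p ℕ.^ b) eq ⟩
        (α * z) ^ (p ℕ.^ b)            ≈⟨ ^-distrib-* α z (p ℕ.^ b) ⟩
        α ^ (p ℕ.^ b) * z ^ (p ℕ.^ b)  ∎

    eigen-+ : ∀ a b → Eigen a → Eigen b → Eigen (a ℕ.+ b)
    eigen-+ a b (α , α∈𝔽q , eqa) (β , β∈𝔽q , eqb) = α ^ (p ℕ.^ b) * β , *-∈𝔽q (^-∈𝔽q (p ℕ.^ b) α∈𝔽q) β∈𝔽q ,
      trans (shift a b eqa) (trans (*-congˡ eqb) (sym (*-assoc _ β z)))

    eigen-∸ : ∀ a b → Eigen (a ℕ.+ b) → Eigen b → Eigen a
    eigen-∸ a b (α , α∈𝔽q , eqab) (β , β∈𝔽q , eqb) = inverse βᵃ βᵃ≉0 * α ,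
      *-∈𝔽q (inverse-∈𝔽q βᵃ≉0 (^-∈𝔽q (p ℕ.^ a) β∈𝔽q)) α∈𝔽q , *-cancelˡ βᵃ≉0 (begin
        βᵃ * z ^ (p ℕ.^ a)                ≈⟨ shift b a eqb ⟨
        z ^ (p ℕ.^ (b ℕ.+ a))             ≡⟨ ≡.cong (λ k → z ^ (p ℕ.^ k)) (ℕ.+-comm b a) ⟩
        z ^ (p ℕ.^ (a ℕ.+ b))             ≈⟨ eqab ⟩
        α * z                             ≈⟨ *-identityˡ _ ⟨
        1# * (α * z)                      ≈⟨ *-congʳ (*-inverseʳ βᵃ βᵃ≉0) ⟨
        βᵃ * inverse βᵃ βᵃ≉0 * (α * z)    ≈⟨ *-assoc βᵃ _ _ ⟩
        βᵃ * (inverse βᵃ βᵃ≉0 * (α * z))  ≈⟨ *-congˡ (*-assoc _ α z) ⟨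
        βᵃ * (inverse βᵃ βᵃ≉0 * α * z)    ∎)
      where
      βᵃ = β ^ (p ℕ.^ a)
      βᵃ≉0 : βᵃ ≉ 0#
      βᵃ≉0 = ^-≉0 (λ β≈0 → z^p^a≉0 b (trans eqb (trans (*-congʳ β≈0) (zeroˡ z)))) (p ℕ.^ a)

    eigen-mn : Eigen (m ℕ.* n)
    eigen-mn = 1# , 1∈𝔽q , trans (fermat z) (sym (*-identityˡ z))

    module _ (eigen-r : Eigen r) where
      eigen-d : Eigen d
      eigen-d = ≡.subst Eigen (≡.sym gcd[m,r]≡gcd[mn,r]) (gcd-closed Eigen eigen-+ eigen-∸ {m ℕ.* n} {r} eigen-mn eigen-r)

      eigen-m : Eigen m
      eigen-m with gcd[m,n]∣m m r
      ... | divides j m≡j*d = ≡.subst Eigen (≡.sym m≡j*d) (*-closed Eigen eigen-+ eigen-∸ eigen-d j)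

      private
        μ = proj₁ eigen-m
        μ∈𝔽q : μ ∈𝔽q
        μ∈𝔽q = proj₁ (proj₂ eigen-m)
        z^q≈μz : z ^ q ≈ μ * z
        z^q≈μz = proj₂ (proj₂ eigen-m)
        λ′ = proj₁ eigen-d
        λ′∈𝔽q : λ′ ∈𝔽q
        λ′∈𝔽q = proj₁ (proj₂ eigen-d)
        z^p^d≈λ′z : z ^ (p ℕ.^ d) ≈ λ′ * z
        z^p^d≈λ′z = proj₂ (proj₂ eigen-d)

      μ≉0 : μ ≉ 0#
      μ≉0 μ≈0 = z^p^a≉0 m (trans z^q≈μz (trans (*-congʳ μ≈0) (zeroˡ z)))

      z^q^i≈μ^iz : ∀ i → z ^ (q ℕ.^ i) ≈ μ ^ i * z
      z^q^i≈μ^iz zero = trans (*-identityʳ z) (sym (*-identityˡ z))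
      z^q^i≈μ^iz (suc i) = begin
        z ^ (q ℕ.* q ℕ.^ i)            ≈⟨ ^-* z q (q ℕ.^ i) ⟩
        (z ^ q) ^ (q ℕ.^ i)            ≈⟨ ^-cong (q ℕ.^ i) z^q≈μz ⟩
        (μ * z) ^ (q ℕ.^ i)            ≈⟨ ^-distrib-* μ z (q ℕ.^ i) ⟩
        μ ^ (q ℕ.^ i) * z ^ (q ℕ.^ i)  ≈⟨ *-cong (∈𝔽q⇒^q^i μ∈𝔽q i) (z^q^i≈μ^iz i) ⟩
        μ * (μ ^ i * z)                ≈⟨ *-assoc μ (μ ^ i) z ⟨
        μ * μ ^ i * z                  ∎

      μ^n≈1 : μ ^ n ≈ 1#
      μ^n≈1 = *-cancelʳ z≉0 (begin
        μ ^ n * z              ≈⟨ z^q^i≈μ^iz n ⟨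
        z ^ (q ℕ.^ n)          ≡⟨ ≡.cong (z ^_) q^n≡N ⟩
        z ^ (p ℕ.^ (m ℕ.* n))  ≈⟨ fermat z ⟩
        z                      ≈⟨ *-identityˡ z ⟨
        1# * z                 ∎)

      μ^p^d≈μ : μ ^ (p ℕ.^ d) ≈ μ
      μ^p^d≈μ = sym (*-cancelˡ λ′z≉0 (begin
        λ′ * z * μ                     ≈⟨ *-assoc λ′ z μ ⟩
        λ′ * (z * μ)                   ≈⟨ *-cong (sym λ′∈𝔽q) (trans (*-comm z μ) (sym z^q≈μz)) ⟩
        λ′ ^ q * z ^ q                 ≈⟨ shift d m z^p^d≈λ′z ⟨
        z ^ (p ℕ.^ (d ℕ.+ m))          ≡⟨ ≡.cong (λ k → z ^ (p ℕ.^ k)) (ℕ.+-comm d m) ⟩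
        z ^ (p ℕ.^ (m ℕ.+ d))          ≈⟨ shift m d z^q≈μz ⟩
        μ ^ (p ℕ.^ d) * z ^ (p ℕ.^ d)  ≈⟨ *-congˡ z^p^d≈λ′z ⟩
        μ ^ (p ℕ.^ d) * (λ′ * z)       ≈⟨ *-comm _ _ ⟩
        λ′ * z * μ ^ (p ℕ.^ d)         ∎))
        where
        λ′z≉0 : λ′ * z ≉ 0#
        λ′z≉0 λ′z≈0 = z^p^a≉0 d (trans z^p^d≈λ′z λ′z≈0)

      μ^[p^d∸1]≈1 : μ ^ (p ℕ.^ d ∸ 1) ≈ 1#
      μ^[p^d∸1]≈1 = *-cancelˡ μ≉0 (begin
        μ * μ ^ (p ℕ.^ d ∸ 1)  ≡⟨ ≡.cong (μ ^_) (ℕ.suc-pred (p ℕ.^ d)) ⟩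
        μ ^ (p ℕ.^ d)          ≈⟨ μ^p^d≈μ ⟩
        μ                      ≈⟨ *-identityʳ μ ⟨
        μ * 1#                 ∎)
        where
        instance
          _ = prime⇒nonZero prime
          _ = ℕ.m^n≢0 p d

      μ≈1 : μ ≈ 1#
      μ≈1 = trans (sym (*-identityʳ μ))
        (≡.subst (λ k → μ ^ k ≈ 1#) gcd[n,p^d-1]≡1 (^≈1-gcd μ n (p ℕ.^ d ∸ 1) μ^n≈1 μ^[p^d∸1]≈1))

      z∈𝔽q : z ∈𝔽q
      z∈𝔽q = trans z^q≈μz (trans (*-congʳ μ≈1) (*-identityˡ z))

      Tr-z≉0 : Tr z ≉ 0#
      Tr-z≉0 Tr-z≈0 = ∤⇒×ᵣ1≉0 p∤n (*-cancelʳ z≉0 (begin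
        n ×ᵣ 1# * z          ≈⟨ ×-assoc-* n 1# z ⟩
        n ×ᵣ (1# * z)        ≈⟨ ×-congʳ n (*-identityˡ z) ⟩
        n ×ᵣ z               ≈⟨ sumTo-const n z ⟨
        sumTo K n (λ _ → z)  ≈⟨ sumTo-cong n (∈𝔽q⇒^q^i z∈𝔽q) ⟨
        Tr z                 ≈⟨ Tr-z≈0 ⟩
        0#                   ≈⟨ zeroˡ z ⟨
        0# * z               ∎))

  traceless-eigenvector≈0 : ∀ {z e} → e ∈𝔽q → z ^ (p ℕ.^ r) ≈ e * z → Tr z ≈ 0# → z ≈ 0#
  traceless-eigenvector≈0 {z} {e} e∈𝔽q z^p^r≈ez Tr-z≈0 with z ≟ 0#
  ... | yes z≈0 = z≈0
  ... | no z≉0 = ⊥-elim (Tr-z≉0 z≉0 (e , e∈𝔽q , z^p^r≈ez) Tr-z≈0)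

  P : ℕ
  P = p ℕ.^ r

  private
    difference : ∀ a X Y B s x y →
      a * (X - Y) + (B - a * s) * (x - y) ≈ (a * (X - x * s) + B * x) - (a * (Y - y * s) + B * y)
    difference = solve 7 (λ a X Y B s x y →
      a :* (X :- Y) :+ (B :- a :* s) :* (x :- y) := (a :* (X :- x :* s) :+ B :* x) :- (a :* (Y :- y :* s) :+ B :* y)) refl

    eliminate : ∀ a⁻¹ a W κ z → a⁻¹ * a * W ≈ a⁻¹ * (a * W + κ * z) + - (κ * a⁻¹) * z
    eliminate = solve 5 (λ a⁻¹ a W κ z → a⁻¹ :* a :* W := a⁻¹ :* (a :* W :+ κ :* z) :+ :- (κ :* a⁻¹) :* z) refl

  module CppMap (a B : Carrier) (a∈𝔽q : a ∈𝔽q) (B∈𝔽q : B ∈𝔽q) where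
    f : Carrier → Carrier
    f = cppMap K q n P a B

    s : Carrier → Carrier
    s x = Tr x ^ (P ∸ 1)

    s-∈𝔽q : ∀ x → s x ∈𝔽q
    s-∈𝔽q x = ^-∈𝔽q (P ∸ 1) (Tr-∈𝔽q x)

    f-cong : ∀ {x y} → x ≈ y → f x ≈ f y
    f-cong x≈y = +-cong (*-congˡ (+-cong (^-cong P x≈y) (-‿cong (*-cong x≈y (^-cong (P ∸ 1) (Tr-cong x≈y)))))) (*-congˡ x≈y)

    Tr-f : ∀ x → Tr (f x) ≈ B * Tr x
    Tr-f x = begin
      Tr (a * (x ^ P - x * s x) + B * x)       ≈⟨ Tr-+ _ _ ⟩
      Tr (a * (x ^ P - x * s x)) + Tr (B * x)  ≈⟨ +-cong (Tr-*ˡ a∈𝔽q _) (Tr-*ˡ B∈𝔽q x) ⟩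
      a * Tr (x ^ P - x * s x) + B * Tr x      ≈⟨ +-congʳ (trans (*-congˡ Tr[x^P-x·s]≈0) (zeroʳ a)) ⟩
      0# + B * Tr x                            ≈⟨ +-identityˡ _ ⟩
      B * Tr x                                 ∎
      where
      instance
        _ = prime⇒nonZero prime
        _ = ℕ.m^n≢0 p r
      Tr[x^P-x·s]≈0 : Tr (x ^ P - x * s x) ≈ 0#
      Tr[x^P-x·s]≈0 = begin
        Tr (x ^ P - x * s x)       ≈⟨ Tr-sub _ _ ⟩
        Tr (x ^ P) - Tr (x * s x)  ≈⟨ +-cong (Tr-^p^ r x) (-‿cong (trans (Tr-cong (*-comm x (s x))) (Tr-*ˡ (s-∈𝔽q x) x))) ⟩
        Tr x ^ P - s x * Tr x      ≡⟨ ≡.cong (λ k → Tr x ^ k - s x * Tr x) (≡.sym (ℕ.suc-pred P)) ⟩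
        Tr x * s x - s x * Tr x    ≈⟨ +-congʳ (*-comm _ _) ⟩
        s x * Tr x - s x * Tr x    ≈⟨ -‿inverseʳ _ ⟩
        0#                         ∎

    f-injective : B ≉ 0# → ∀ x y → f x ≈ f y → x ≈ y
    f-injective B≉0 x y fx≈fy = x∙y⁻¹≈ε⇒x≈y x y z≈0
      where
      z = x - y
      κ = B - a * s x

      Tr-x≈Tr-y : Tr x ≈ Tr y
      Tr-x≈Tr-y = *-cancelˡ B≉0 (trans (sym (Tr-f x)) (trans (Tr-cong fx≈fy) (Tr-f y)))

      Tr-z≈0 : Tr z ≈ 0#
      Tr-z≈0 = trans (Tr-sub x y) (trans (+-congʳ Tr-x≈Tr-y) (-‿inverseʳ _))

      linear : a * z ^ P + κ * z ≈ 0#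
      linear = begin
        a * z ^ P + κ * z                              ≈⟨ +-congʳ (*-congˡ z^P≈x^P-y^P) ⟩
        a * (x ^ P - y ^ P) + (B - a * s x) * (x - y)  ≈⟨ difference a (x ^ P) (y ^ P) B (s x) x y ⟩
        f x - (a * (y ^ P - y * s x) + B * y)          ≈⟨ +-congˡ (-‿cong fy≈) ⟩
        f x - f y                                      ≈⟨ x≈y⇒x∙y⁻¹≈ε fx≈fy ⟩
        0#                                             ∎
        where
        z^P≈x^P-y^P : z ^ P ≈ x ^ P - y ^ P
        z^P≈x^P-y^P = trans (additive-p^ r x (- y)) (+-congˡ (additive-neg P (additive-p^ r) y))
        fy≈ : a * (y ^ P - y * s x) + B * y ≈ f y
        fy≈ = +-congʳ (*-congˡ (+-congˡ (-‿cong (*-congˡ (^-cong (P ∸ 1) Tr-x≈Tr-y)))))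

      z≈0 : z ≈ 0#
      z≈0 with a ≟ 0#
      ... | yes a≈0 = *≈0⇒≈0 B≉0 (begin
        B * z              ≈⟨ *-congʳ κ≈B ⟨
        κ * z              ≈⟨ +-identityˡ _ ⟨
        0# + κ * z         ≈⟨ +-congʳ (trans (*-congʳ a≈0) (zeroˡ _)) ⟨
        a * z ^ P + κ * z  ≈⟨ linear ⟩
        0#                 ∎)
        where
        κ≈B : κ ≈ B
        κ≈B = trans (+-congˡ (trans (-‿cong (trans (*-congʳ a≈0) (zeroˡ _))) ε⁻¹≈ε)) (+-identityʳ B)
      ... | no a≉0 = traceless-eigenvector≈0 e∈𝔽q z^P≈ez Tr-z≈0
        where
        a⁻¹ = inverse a a≉0
        e = - (κ * a⁻¹)
        e∈𝔽q : e ∈𝔽q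
        e∈𝔽q = -‿∈𝔽q (*-∈𝔽q (+-∈𝔽q B∈𝔽q (-‿∈𝔽q (*-∈𝔽q a∈𝔽q (s-∈𝔽q x)))) (inverse-∈𝔽q a≉0 a∈𝔽q))
        z^P≈ez : z ^ P ≈ e * z
        z^P≈ez = begin
          z ^ P                              ≈⟨ *-identityˡ _ ⟨
          1# * z ^ P                         ≈⟨ *-congʳ (*-inverseˡ a a≉0) ⟨
          a⁻¹ * a * z ^ P                    ≈⟨ eliminate a⁻¹ a (z ^ P) κ z ⟩
          a⁻¹ * (a * z ^ P + κ * z) + e * z  ≈⟨ +-congʳ (trans (*-congˡ linear) (zeroʳ a⁻¹)) ⟩
          0# + e * z                         ≈⟨ +-identityˡ _ ⟩
          e * z                              ∎

  cppMap-+-id : ∀ a B x → cppMap K q n P a B x + x ≈ cppMap K q n P a (B + 1#) x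
  cppMap-+-id a B x = trans (+-assoc _ _ x) (+-congˡ (begin
    B * x + x       ≈⟨ +-congˡ (*-identityˡ x) ⟨
    B * x + 1# * x  ≈⟨ distribʳ x B 1# ⟨
    (B + 1#) * x    ∎))

  cppMap-complete : ∀ {a b} → a ∈𝔽q → b ∈𝔽q → b ≉ 0# → b ≉ - 1# → IsCompletePermutation K (cppMap K q n P a b)
  cppMap-complete {a} {b} a∈𝔽q b∈𝔽q b≉0 b≉-1 =
    injective⇒permutation f f-cong (f-injective b≉0) ,
    injective⇒permutation (λ x → f x + x) (λ x≈y → +-cong (f-cong x≈y) x≈y)
      (λ x y fx+x≈fy+y → F.f-injective b+1≉0 x y (trans (sym (cppMap-+-id a b x)) (trans fx+x≈fy+y (cppMap-+-id a b y))))
    where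
    open CppMap a b a∈𝔽q b∈𝔽q
    module F = CppMap a (b + 1#) a∈𝔽q (+-∈𝔽q b∈𝔽q 1∈𝔽q)
    b+1≉0 : b + 1# ≉ 0#
    b+1≉0 b+1≈0 = b≉-1 (inverseˡ-unique b 1# b+1≈0)

open import Data.Nat using (_*_; _^_)
open CommutativeRing using (Carrier; _≈_; 0#; 1#; -_)

corollary3p5 : ∀ {c ℓ} (p m n r : ℕ) → Prime p → m ≥ 1 → n ≥ 1 → r ≥ 1
    → gcd m r ≡ gcd (m * n) r → ¬ (p ∣ n) → gcd n (p ^ gcd m r ∸ 1) ≡ 1
    → (K : CommutativeRing c ℓ) → IsField K → HasCardinality K (p ^ (m * n))
    → (a b : Carrier K)
    → _≈_ K (pow K a (p ^ m)) a → _≈_ K (pow K b (p ^ m)) b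
    → ¬ (_≈_ K b (0# K)) → ¬ (_≈_ K b (-_ K (1# K)))
    → IsCompletePermutation K (cppMap K (p ^ m) n (p ^ r) a b)
corollary3p5 p m n r prime _ _ _ gcd[m,r]≡gcd[mn,r] p∤n gcd[n,p^d-1]≡1 K isField card a b a∈𝔽q b∈𝔽q b≉0 b≉-1 =
  CompletePermutation.cppMap-complete K isField prime m n r card gcd[m,r]≡gcd[mn,r] p∤n gcd[n,p^d-1]≡1
    a∈𝔽q b∈𝔽q b≉0 b≉-1
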